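{- Let $\Lambda$ be an admissible $d$-colored multigraph on the vertex set $V$ and let $T\subset[d]$. Let $V=X\cup(V\setminus X)$ be a partition such that for all $x\in X$ and $y\in V\setminus X$, $x$ and $y$ are disconnected on $\Lambda_T$. If $u,v$ are vertices in $X$, then for all $x\in X\setminus\{u,v\}$ and $y\in V\setminus X$, $x$ and $y$ are disconnected on $(\mathrm{del}_{\{u,v\}}\Lambda)_T$.
   Context: A $d$-colored multigraph is a pair $\Lambda=(G,\gamma)$ with $G=(V,E,\phi)$ a finite loopless multigraph ($\phi(e)$ is the 2-element vertex set of edge $e$) and $\gamma:E\to[d]$. For $T\subset[d]$, $\Lambda_T$ is the multigraph on $V$ with edge set $\{e:\gamma(e)\in T\}$. $\Lambda$ is admissible if $G$ is connected and for each $i\in[d]$ the edges of color $i$ form a perfect matching on $V$. Two vertices are connected on a multigraph if there is a path joining them, and disconnected otherwise. For distinct vertices $x,y$ of admissible $\Lambda$, let $C=\{\gamma(e):\phi(e)=\{x,y\}\}$; for each $i\in[d]\setminus C$ let $a_i,b_i$ be the vertices with color-$i$ edges $\{a_i,x\}$ and $\{y,b_i\}$. The cancelling $\mathrm{del}_{\{x,y\}}\Lambda$ is the $d$-colored multigraph obtained by deleting $x,y$ and all edges incident to them, and adding for each $i\in[d]\setminus C$ a new edge of color $i$ between $a_i$ and $b_i$. -}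

module Defs where

open import Data.Nat using (ℕ)
open import Data.Fin using (Fin)
open import Data.Fin.Subset using (Subset; _∈_; ⊤)
open import Data.Product using (Σ; ∃; _×_; _,_; proj₁; proj₂)
open import Data.Sum using (_⊎_; inj₁; inj₂)
open import Relation.Nullary using (¬_)
open import Relation.Binary.PropositionalEquality using (_≡_; _≢_; refl; sym; trans; cong; subst)
open import Relation.Binary.Construct.Closure.ReflexiveTransitive using (Star)
open import Function.Bundles using (_↔_)

-- A d-colored multigraph: vertex type V, edge type E,
-- ends e = (p , q) encodes φ(e) = {p , q}, color e = γ(e) ∈ [d] (= Fin d).
record CMG (d : ℕ) : Set₁ where
  field
    V     : Set
    E     : Set
    ends  : E → V × V
    color : E → Fin d

module _ {d : ℕ} (Λ : CMG d) where
  open CMG Λ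

  Inc : E → V → Set
  Inc e x = proj₁ (ends e) ≡ x ⊎ proj₂ (ends e) ≡ x

  Joins : E → V → V → Set
  Joins e x y = ends e ≡ (x , y) ⊎ ends e ≡ (y , x)

  Loopless : Set
  Loopless = ∀ e → proj₁ (ends e) ≢ proj₂ (ends e)

  IsFinite : Set
  IsFinite = (Σ ℕ λ n → V ↔ Fin n) × (Σ ℕ λ m → E ↔ Fin m)

  AdjOn : Subset d → V → V → Set
  AdjOn T x y = Σ E λ e → color e ∈ T × Joins e x y

  ConnectedOn : Subset d → V → V → Set
  ConnectedOn T = Star (AdjOn T)

  IsConnected : Set
  IsConnected = ∀ x y → ConnectedOn ⊤ x y

  PerfectMatching : Fin d → Set
  PerfectMatching i = ∀ x → Σ E λ e → (color e ≡ i × Inc e x)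
                                     × (∀ e' → color e' ≡ i → Inc e' x → e' ≡ e)

  record Admissible : Set where
    field
      finite    : IsFinite
      loopless  : Loopless
      connected : IsConnected
      matching  : ∀ i → PerfectMatching i

  otherEnd : (e : E) (x : V) → Inc e x → V
  otherEnd e x (inj₁ _) = proj₂ (ends e)
  otherEnd e x (inj₂ _) = proj₁ (ends e)

  otherEnd-joins : (e : E) (x : V) (p : Inc e x) → Joins e x (otherEnd e x p)
  otherEnd-joins e x (inj₁ q) = inj₁ (cong (λ z → z , proj₂ (ends e)) q)
  otherEnd-joins e x (inj₂ q) = inj₂ (cong (λ z → proj₁ (ends e) , z) q)

  otherEnd-≢ : Loopless → (e : E) (x : V) (p : Inc e x) → otherEnd e x p ≢ x
  otherEnd-≢ ll e x (inj₁ q) r = ll e (trans q (sym r))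
  otherEnd-≢ ll e x (inj₂ q) r = ll e (trans r (sym q))

  -- i ∈ C = { γ(e) : φ(e) = {u , v} }
  BetweenColor : V → V → Fin d → Set
  BetweenColor u v i = Σ E λ e → color e ≡ i × Joins e u v

  -- Edges: the edges of Λ not incident to u or v, together with one new edge
  -- of colour i for every i ∉ C, joining a_i and b_i, where {a_i , u} and
  -- {v , b_i} are the colour-i edges at u and v (given by the perfect matchings).
  module _ (adm : Admissible) (u v : V) where
    open Admissible adm

    DelV : Set
    DelV = Σ V λ w → w ≢ u × w ≢ v

    DelE : Set
    DelE = (Σ E λ e → ¬ Inc e u × ¬ Inc e v) ⊎ (Σ (Fin d) λ i → ¬ BetweenColor u v i)

    private
      eu : Fin d → E
      eu i = proj₁ (matching i u)
      eu-col : ∀ i → color (eu i) ≡ i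
      eu-col i = proj₁ (proj₁ (proj₂ (matching i u)))
      eu-inc : ∀ i → Inc (eu i) u
      eu-inc i = proj₂ (proj₁ (proj₂ (matching i u)))
      ev : Fin d → E
      ev i = proj₁ (matching i v)
      ev-col : ∀ i → color (ev i) ≡ i
      ev-col i = proj₁ (proj₁ (proj₂ (matching i v)))
      ev-inc : ∀ i → Inc (ev i) v
      ev-inc i = proj₂ (proj₁ (proj₂ (matching i v)))

      joinsSwap : ∀ e x y → Joins e x y → Joins e y x
      joinsSwap e x y (inj₁ p) = inj₂ p
      joinsSwap e x y (inj₂ p) = inj₁ p

    aVert : (i : Fin d) → ¬ BetweenColor u v i → DelV
    aVert i ni = a , otherEnd-≢ loopless (eu i) u (eu-inc i) , a≢v
      where
        a = otherEnd (eu i) u (eu-inc i)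
        a≢v : a ≢ v
        a≢v eq = ni (eu i , eu-col i ,
                     subst (Joins (eu i) u) eq (otherEnd-joins (eu i) u (eu-inc i)))

    bVert : (i : Fin d) → ¬ BetweenColor u v i → DelV
    bVert i ni = b , b≢u , otherEnd-≢ loopless (ev i) v (ev-inc i)
      where
        b = otherEnd (ev i) v (ev-inc i)
        b≢u : b ≢ u
        b≢u eq = ni (ev i , ev-col i ,
                     joinsSwap (ev i) v u
                       (subst (Joins (ev i) v) eq (otherEnd-joins (ev i) v (ev-inc i))))

    delEnds : DelE → DelV × DelV
    delEnds (inj₁ (e , nu , nv)) =
      (proj₁ (ends e) , (λ q → nu (inj₁ q)) , (λ q → nv (inj₁ q))) ,
      (proj₂ (ends e) , (λ q → nu (inj₂ q)) , (λ q → nv (inj₂ q)))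
    delEnds (inj₂ (i , ni)) = aVert i ni , bVert i ni

    delColor : DelE → Fin d
    delColor (inj₁ (e , _)) = color e
    delColor (inj₂ (i , _)) = i

    del : CMG d
    del = record { V = DelV ; E = DelE ; ends = delEnds ; color = delColor }

module Submission where

-- Call a vertex of Λ "inside" when it is not outside X, i.e.
-- when ¬ ¬ X holds of it.  The separation hypothesis says exactly that no
-- T-edge of Λ leaves X, hence "inside" is invariant along T-edges of Λ
-- (`inside-respects-adj`).  In particular u, v ∈ X and every vertex that is
-- T-adjacent to u or to v is inside.  The T-edges of the cancelling
-- del_{u,v} Λ are of two kinds (`del-adjacency`): restrictions of T-edges
-- of Λ, and new edges {a_i , b_i} with i ∈ T, whose ends are T-adjacent to
-- u respectively v through the colour-i edges of Λ.  Either way "inside"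
-- is preserved, so it is preserved along every path of (del_{u,v} Λ)_T
-- (`respects-star`).  A path from x ∈ X to y ∉ X would therefore make y
-- inside, contradicting ¬ X y.
--
-- The double negation is what makes the argument constructive: X is an
-- arbitrary (possibly undecidable) predicate, and ¬ ¬ X is the largest
-- predicate the separation hypothesis lets us propagate.

open import Defs
open import Data.Nat using (ℕ)
open import Data.Fin.Subset using (Subset; _∈_)
open import Data.Product using (_×_; _,_; proj₁; proj₂)
open import Data.Sum using (_⊎_; inj₁; inj₂)
open import Relation.Nullary using (¬_)
open import Relation.Binary.Core using (Rel)
open import Relation.Binary.Definitions using (_Respects_)
open import Relation.Binary.PropositionalEquality using (_≢_; _≡_; refl; sym; subst; cong)
open import Relation.Binary.Construct.Closure.ReflexiveTransitive using (Star; ε; _◅_)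

respects-star : ∀ {a ℓ p} {A : Set a} {R : Rel A ℓ} {P : A → Set p} →
                P Respects R → P Respects (Star R)
respects-star step ε        Px = Px
respects-star step (r ◅ rs) Px = respects-star step rs (step r Px)

module _ {d : ℕ} (Λ : CMG d) (adm : Admissible Λ) (T : Subset d) where
  open CMG Λ
  open Admissible adm

  matching-adj : ∀ z i → i ∈ T →
    let (e , (col , inc) , _) = matching i z in AdjOn Λ T z (otherEnd Λ e z inc)
  matching-adj z i i∈T =
    let (e , (col , inc) , _) = matching i z
    in e , subst (_∈ T) (sym col) i∈T , otherEnd-joins Λ e z inc

  Touches : V → V → V → Set
  Touches u v z = AdjOn Λ T u z ⊎ AdjOn Λ T v z

  module _ (u v : V) where
    private
      D = del Λ adm u v

      underlying : {a b c e : DelV Λ adm u v} → (a , b) ≡ (c , e) →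
                   (proj₁ a , proj₁ b) ≡ (proj₁ c , proj₁ e)
      underlying refl = refl

    del-adjacency : ∀ {x w} → AdjOn D T x w →
                    AdjOn Λ T (proj₁ x) (proj₁ w)
                    ⊎ (Touches u v (proj₁ x) × Touches u v (proj₁ w))
    del-adjacency (inj₁ (e , _) , i∈T , inj₁ j) = inj₁ (e , i∈T , inj₁ (underlying j))
    del-adjacency (inj₁ (e , _) , i∈T , inj₂ j) = inj₁ (e , i∈T , inj₂ (underlying j))
    del-adjacency (inj₂ (i , _) , i∈T , inj₁ j) = inj₂
      ( subst (Touches u v) (cong proj₁ (underlying j)) (inj₁ (matching-adj u i i∈T))
      , subst (Touches u v) (cong proj₂ (underlying j)) (inj₂ (matching-adj v i i∈T)))
    del-adjacency (inj₂ (i , _) , i∈T , inj₂ j) = inj₂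
      ( subst (Touches u v) (cong proj₂ (underlying j)) (inj₂ (matching-adj v i i∈T))
      , subst (Touches u v) (cong proj₁ (underlying j)) (inj₁ (matching-adj u i i∈T)))

  module _ (X : V → Set) (separated : ∀ x y → X x → ¬ X y → ¬ ConnectedOn Λ T x y) where

    Inside : V → Set
    Inside z = ¬ ¬ X z

    X⇒Inside : ∀ {z} → X z → Inside z
    X⇒Inside Xz ¬Xz = ¬Xz Xz

    -- No T-edge of Λ leaves X, so "inside" is invariant along T-edges.
    inside-respects-adj : Inside Respects AdjOn Λ T
    inside-respects-adj {x} {y} adj insideX ¬Xy =
      insideX (λ Xx → separated x y Xx ¬Xy (adj ◅ ε))

    inside-respects-del-adj : ∀ u v → X u → X v →
                              (λ z → Inside (proj₁ z)) Respects AdjOn (del Λ adm u v) T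
    inside-respects-del-adj u v Xu Xv adj insideX with del-adjacency u v adj
    ... | inj₁ adjΛ          = inside-respects-adj adjΛ insideX
    ... | inj₂ (_ , touches) = touching-inside touches
      where
        touching-inside : ∀ {z} → Touches u v z → Inside z
        touching-inside (inj₁ adjU) = inside-respects-adj adjU (X⇒Inside Xu)
        touching-inside (inj₂ adjV) = inside-respects-adj adjV (X⇒Inside Xv)

lemma6p9 : {d : ℕ} (Λ : CMG d) (adm : Admissible Λ) (T : Subset d)
           (X : CMG.V Λ → Set) →
           (∀ x y → X x → ¬ X y → ¬ ConnectedOn Λ T x y) →
           (u v : CMG.V Λ) → u ≢ v → X u → X v →
           (x y : DelV Λ adm u v) → X (proj₁ x) → ¬ X (proj₁ y) →
           ¬ ConnectedOn (del Λ adm u v) T x y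
lemma6p9 Λ adm T X separated u v _ Xu Xv x y Xx ¬Xy path =
  respects-star (inside-respects-del-adj Λ adm T X separated u v Xu Xv)
                path (X⇒Inside Λ adm T X separated Xx) ¬Xy
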